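{- Let $x$ be a sequence of pairwise distinct integers of length $m$, $i\in\{1,\ldots,m-1\}$ with $x[i]<x[i+1]$, and $y=\tau(x,i)$. Then $SN_y[i]\in\{0,\ldots,SN_x[i]\}$, $SN_y[i+1]=SN_x[i]-SN_y[i]+1$, and, if $\mathrm{ref}_x(i+1)\neq -1$, $SN_y[\mathrm{ref}_x(i+1)]=SN_x[\mathrm{ref}_x(i+1)]-1$.
   Context: $\tau(x,i)$ exchanges $x[i]$ and $x[i+1]$. The Cartesian tree $C(x)$ of $x[1\ldots m]$ has as root the node labeled by the position $g$ of the minimum of $x$, left subtree $C(x[1\ldots g-1])$ and right subtree the Cartesian tree of $x[g+1\ldots m]$ (nodes labeled by positions). $C_h(x)$ is the subtree rooted at node $h$. $SN_x[h]$ is the number of nodes on the right branch (root and successive right children) of the left subtree of $C_h(x)$ ($0$ if that subtree is empty). $\mathrm{ref}_x(h)$ is the smallest position $j>h$ with $x[j]<x[h]$, and $-1$ if none exists. -}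

module Defs where

open import Data.Nat using (ℕ; zero; suc; _+_; _∸_)
open import Data.Integer as ℤ using (ℤ)
open import Data.List using (List; []; _∷_; length; take; drop; map; upTo; filter)
open import Data.Maybe using (Maybe; just; nothing)
open import Data.Product using (_×_; _,_)
open import Relation.Nullary using (yes; no)

-- Binary trees whose nodes are labelled by positions (1-based).
data Tree : Set where
  leaf : Tree
  node : Tree → ℕ → Tree → Tree

-- x[j], 1-based; default 0 outside 1..m (never used there).
get : List ℤ → ℕ → ℤ
get []       _             = ℤ.0ℤ
get (a ∷ xs) zero          = ℤ.0ℤ
get (a ∷ xs) (suc zero)    = a
get (a ∷ xs) (suc (suc j)) = get xs (suc j)

-- (0-based index, value) of the minimum of the nonempty list a ∷ xs.
minIdx : ℤ → List ℤ → ℕ × ℤ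
minIdx a [] = 0 , a
minIdx a (b ∷ bs) with minIdx b bs
... | k , v with v ℤ.<? a
...   | yes _ = suc k , v
...   | no  _ = 0 , a

-- Cartesian tree of a list whose first element sits at position off+1,
-- with fuel (fuel = length suffices).
ctF : ℕ → ℕ → List ℤ → Tree
ctF zero     off _        = leaf
ctF (suc n)  off []       = leaf
ctF (suc n)  off (a ∷ xs) with minIdx a xs
... | g , _ = node (ctF n off (take g (a ∷ xs)))
                   (off + suc g)
                   (ctF n (off + suc g) (drop (suc g) (a ∷ xs)))

C : List ℤ → Tree
C x = ctF (length x) 0 x

subtreeAt : ℕ → Tree → Maybe Tree
subtreeAt h leaf = nothing
subtreeAt h (node l k r) with h Data.Nat.≟ k
  where import Data.Nat
... | yes _ = just (node l k r)
... | no  _ with subtreeAt h l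
...   | just t  = just t
...   | nothing = subtreeAt h r

rightBranch : Tree → ℕ
rightBranch leaf         = 0
rightBranch (node _ _ r) = suc (rightBranch r)

leftSub : Tree → Tree
leftSub leaf         = leaf
leftSub (node l _ _) = l

SN : List ℤ → ℕ → ℕ
SN x h with subtreeAt h (C x)
... | just t  = rightBranch (leftSub t)
... | nothing = 0

-- ref_x(h): smallest j > h (j ≤ m) with x[j] < x[h]; nothing encodes -1.
head? : List ℕ → Maybe ℕ
head? []      = nothing
head? (j ∷ _) = just j

ref : List ℤ → ℕ → Maybe ℕ
ref x h = head? (filter (λ j → get x j ℤ.<? get x h)
                        (map (λ k → suc h + k) (upTo (length x ∸ h))))

τ : List ℤ → ℕ → List ℤ
τ (a ∷ b ∷ xs) (suc zero)    = b ∷ a ∷ xs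
τ (a ∷ xs)     (suc (suc i)) = a ∷ τ xs (suc i)
τ xs           _             = xs

{-# OPTIONS --safe #-}
module Submission where

-- Read x from left to right, keeping the right branch of the Cartesian tree of the prefix read so far as a
-- stack: pushing w first pops every entry larger than w, and the popped entries are exactly the right branch
-- of the left subtree of w's node, so SN_x[h] is the number of entries popped when x[h] is pushed.
-- Exchanging an ascent a = x[i] < x[i+1] = b only changes the pushes at positions i and i+1: in τ(x,i), b pops
-- the entries above b, then a pops b together with the remaining entries above a, whence the first two claims.
-- Afterwards the stack of x is that of τ(x,i) with one extra entry b right above a; it stays buried under larger
-- values until the first later value below b, which is x[ref(i+1)], pops it.

open import Defs
open import Data.Nat as ℕ using (ℕ; zero; suc; _+_; _∸_; _≤_; _<_; z≤n; s≤s)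
open import Data.Nat.Properties
  using (+-comm; +-assoc; m≤m+n; ≤-refl; ≤-trans; ≤-pred; ≤-<-trans; <-trans; <⇒≢; >⇒≢;
         n<1+n; m<n⇒m<1+n; +-monoʳ-≤; +-monoʳ-<)
open import Data.Integer as ℤ using (ℤ)
import Data.Integer.Properties as ℤP
open import Data.List
  using (List; []; _∷_; _++_; _∷ʳ_; length; foldl; take; drop; takeWhile; dropWhile; filter; applyUpTo)
open import Data.List.Properties
  using (∷-injective; ++-assoc; ∷ʳ-++; length-++; length-++-sucʳ; foldl-++; foldl-∷ʳ; map-applyUpTo)
open import Data.List.Relation.Unary.All as All using (All; []; _∷_)
open import Data.List.Relation.Unary.All.Properties using (++⁺; ++⁻ˡ; ++⁻ʳ; dropWhile⁺)
open import Data.List.Relation.Unary.AllPairs using ([]; _∷_)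
open import Data.List.Relation.Unary.Unique.Propositional using (Unique)
open import Data.Maybe using (just; nothing)
open import Data.Product using (_×_; _,_; ∃-syntax; proj₁; uncurry)
open import Function using (_∘_; id)
open import Relation.Nullary using (¬_; yes; no; contradiction)
open import Relation.Unary using (Pred; Decidable; _⊆_; ∁)
open import Relation.Binary.PropositionalEquality
  using (_≡_; _≢_; ≢-sym; refl; sym; trans; cong; cong₂; subst; subst₂; module ≡-Reasoning)
open import Relation.Binary.PropositionalEquality.Properties using (setoid)
open import Data.List.Relation.Binary.Permutation.Setoid (setoid ℤ) using (↭-swap; ↭-refl)
open import Data.List.Relation.Binary.Permutation.Setoid.Properties (setoid ℤ) using (Unique-resp-↭; ++⁺ˡ)

module _ {a p} {A : Set a} {P : Pred A p} (P? : Decidable P) where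

  takeWhile-accept : ∀ {x xs} → P x → takeWhile P? (x ∷ xs) ≡ x ∷ takeWhile P? xs
  takeWhile-accept {x} px with P? x
  ... | yes _  = refl
  ... | no ¬px = contradiction px ¬px

  dropWhile-accept : ∀ {x xs} → P x → dropWhile P? (x ∷ xs) ≡ dropWhile P? xs
  dropWhile-accept {x} px with P? x
  ... | yes _  = refl
  ... | no ¬px = contradiction px ¬px

  takeWhile-all : ∀ {xs} → All P xs → takeWhile P? xs ≡ xs
  takeWhile-all []         = refl
  takeWhile-all (px ∷ pxs) = trans (takeWhile-accept px) (cong (_ ∷_) (takeWhile-all pxs))

  takeWhile-++-all : ∀ {xs} ys → All P xs → takeWhile P? (xs ++ ys) ≡ xs ++ takeWhile P? ys
  takeWhile-++-all ys []         = refl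
  takeWhile-++-all ys (px ∷ pxs) = trans (takeWhile-accept px) (cong (_ ∷_) (takeWhile-++-all ys pxs))

  takeWhile-++-reject : ∀ xs {y ys} → ¬ P y → takeWhile P? (xs ++ y ∷ ys) ≡ takeWhile P? xs
  takeWhile-++-reject [] {y} ¬py with P? y
  ... | yes py = contradiction py ¬py
  ... | no _   = refl
  takeWhile-++-reject (x ∷ xs) ¬py with P? x
  ... | yes _ = cong (x ∷_) (takeWhile-++-reject xs ¬py)
  ... | no _  = refl

  dropWhile-++-reject : ∀ xs {y ys} → ¬ P y → dropWhile P? (xs ++ y ∷ ys) ≡ dropWhile P? xs ++ y ∷ ys
  dropWhile-++-reject [] {y} ¬py with P? y
  ... | yes py = contradiction py ¬py
  ... | no _   = refl
  dropWhile-++-reject (x ∷ xs) ¬py with P? x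
  ... | yes _ = dropWhile-++-reject xs ¬py
  ... | no _  = refl

  dropWhile-all : ∀ {xs} → All P xs → dropWhile P? xs ≡ []
  dropWhile-all []         = refl
  dropWhile-all (px ∷ pxs) = trans (dropWhile-accept px) (dropWhile-all pxs)

module _ {a p q} {A : Set a} {P : Pred A p} {Q : Pred A q}
         (P? : Decidable P) (Q? : Decidable Q) (P⊆Q : P ⊆ Q) where

  dropWhile-dropWhile : ∀ xs → dropWhile Q? (dropWhile P? xs) ≡ dropWhile Q? xs
  dropWhile-dropWhile [] = refl
  dropWhile-dropWhile (x ∷ xs) with P? x
  ... | yes px = trans (dropWhile-dropWhile xs) (sym (dropWhile-accept Q? (P⊆Q px)))
  ... | no _   = refl

  takeWhile++takeWhile-dropWhile : ∀ xs →
    takeWhile P? xs ++ takeWhile Q? (dropWhile P? xs) ≡ takeWhile Q? xs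
  takeWhile++takeWhile-dropWhile [] = refl
  takeWhile++takeWhile-dropWhile (x ∷ xs) with P? x
  ... | yes px = trans (cong (x ∷_) (takeWhile++takeWhile-dropWhile xs)) (sym (takeWhile-accept Q? (P⊆Q px)))
  ... | no _   = refl

module _ {a} {A : Set a} where

  data Cuts : List A → A → List A → List A → A → List A → Set a where
    before : ∀ P w M v R → Cuts P w (M ++ v ∷ R) (P ++ w ∷ M) v R
    same   : ∀ P w Q → Cuts P w Q P w Q
    after  : ∀ L v M w Q → Cuts (L ++ v ∷ M) w Q L v (M ++ w ∷ Q)

  cuts : ∀ P w Q L v R → P ++ w ∷ Q ≡ L ++ v ∷ R → Cuts P w Q L v R
  cuts []      w Q []      v R refl = same [] w Q
  cuts []      w Q (x ∷ L) v R refl = before [] w L v R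
  cuts (x ∷ P) w Q []      v R refl = after [] v P w Q
  cuts (x ∷ P) w Q (y ∷ L) v R eq with ∷-injective eq
  ... | refl , eq′ with cuts P w Q L v R eq′
  ... | before _ _ M _ _ = before (x ∷ P) w M v R
  ... | same _ _ _       = same (x ∷ P) w Q
  ... | after _ _ M _ _  = after (x ∷ L) v M w Q

  []≢++∷ : ∀ P {w : A} {Q} → [] ≢ P ++ w ∷ Q
  []≢++∷ []      ()
  []≢++∷ (_ ∷ _) ()

  length-<-++-∷ˡ : ∀ P {w : A} {Q} → length P < length (P ++ w ∷ Q)
  length-<-++-∷ˡ []      = s≤s z≤n
  length-<-++-∷ˡ (_ ∷ P) = s≤s (length-<-++-∷ˡ P)

  length-<-++-∷ʳ : ∀ P {w : A} {Q} → length Q < length (P ++ w ∷ Q)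
  length-<-++-∷ʳ []      = n<1+n _
  length-<-++-∷ʳ (_ ∷ P) = m<n⇒m<1+n (length-<-++-∷ʳ P)

  length-∷ʳ : ∀ (xs : List A) {x} → length (xs ∷ʳ x) ≡ suc (length xs)
  length-∷ʳ xs = trans (length-++ xs) (+-comm (length xs) 1)

  +-suc-length-++ : ∀ off (L X : List A) → off + suc (length L) + length X ≡ off + suc (length (L ++ X))
  +-suc-length-++ off L X =
    trans (+-assoc off (suc (length L)) (length X)) (cong (λ m → off + suc m) (sym (length-++ L)))

  length-++-∷-∷ : ∀ P {c d : A} Q → length (P ++ c ∷ d ∷ Q) ≡ suc (suc (length P + length Q))
  length-++-∷-∷ []      Q = refl
  length-++-∷-∷ (_ ∷ P) Q = cong suc (length-++-∷-∷ P Q)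

  Unique-++-∷⁻ : ∀ L {v : A} {R} → Unique (L ++ v ∷ R) →
    Unique L × Unique R × All (v ≢_) L × All (v ≢_) R
  Unique-++-∷⁻ []      (v∉R ∷ uR) = [] , uR , [] , v∉R
  Unique-++-∷⁻ (x ∷ L) (x∉ ∷ u) with Unique-++-∷⁻ L u
  ... | uL , uR , v∉L , v∉R = ++⁻ˡ L x∉ ∷ uL , uR , ≢-sym (All.head (++⁻ʳ L x∉)) ∷ v∉L , v∉R

Unique-swap : ∀ P {a b : ℤ} S → Unique (P ++ a ∷ b ∷ S) → Unique (P ++ b ∷ a ∷ S)
Unique-swap P {a} {b} S = Unique-resp-↭ (++⁺ˡ P (↭-swap a b ↭-refl))

All-≤∧≢⇒< : ∀ {v xs} → All (v ℤ.≤_) xs → All (v ≢_) xs → All (v ℤ.<_) xs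
All-≤∧≢⇒< v≤xs v≢xs = All.zipWith (uncurry ℤP.≤∧≢⇒<) (v≤xs , v≢xs)

-- The stack of the Cartesian tree construction

-- stack P is the right branch of C(P), listed from its deepest node up to the root.
push : List ℤ → ℤ → List ℤ
push S w = w ∷ dropWhile (w ℤ.<?_) S

stack : List ℤ → List ℤ
stack = foldl push []

popped : ℤ → List ℤ → ℕ
popped w S = length (takeWhile (w ℤ.<?_) S)

module _ {p} {P : Pred ℤ p} where

  foldl-push⁺ : ∀ {S} xs → All P S → All P xs → All P (foldl push S xs)
  foldl-push⁺ []       pS []         = pS
  foldl-push⁺ (x ∷ xs) pS (px ∷ pxs) = foldl-push⁺ xs (px ∷ dropWhile⁺ _ pS) pxs

  stack⁺ : ∀ {xs} → All P xs → All P (stack xs)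
  stack⁺ = foldl-push⁺ _ []

foldl-push-++-∷ : ∀ {v} T S {R} → All (v ℤ.<_) R → foldl push (T ++ v ∷ S) R ≡ foldl push T R ++ v ∷ S
foldl-push-++-∷ T S []                       = refl
foldl-push-++-∷ T S {r ∷ R} (v<r ∷ v<R) =
  trans (cong (λ U → foldl push (r ∷ U) R) (dropWhile-++-reject (r ℤ.<?_) T (ℤP.<-asym v<r)))
        (foldl-push-++-∷ (push T r) S v<R)

stack-++-∷ : ∀ L {v R} → All (v ℤ.<_) L → All (v ℤ.<_) R → stack (L ++ v ∷ R) ≡ stack R ∷ʳ v
stack-++-∷ L {v} {R} v<L v<R = begin
  stack (L ++ v ∷ R)               ≡⟨ foldl-++ push [] L (v ∷ R) ⟩
  foldl push (push (stack L) v) R  ≡⟨ cong (λ S → foldl push (v ∷ S) R) (dropWhile-all _ (stack⁺ v<L)) ⟩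
  foldl push ([] ++ v ∷ []) R      ≡⟨ foldl-push-++-∷ [] [] v<R ⟩
  stack R ∷ʳ v                     ∎
  where open ≡-Reasoning

popped-++ : ∀ {c T} U → All (c ℤ.<_) T → popped c (T ++ U) ≡ length T + popped c U
popped-++ {c} {T} U c<T = trans (cong length (takeWhile-++-all (c ℤ.<?_) U c<T)) (length-++ T)

popped-stack-++-∷ : ∀ L {v w M} → All (v ℤ.<_) L → All (v ℤ.<_) M → v ℤ.< w →
  popped w (stack (L ++ v ∷ M)) ≡ popped w (stack M)
popped-stack-++-∷ L {v} {w} {M} v<L v<M v<w = begin
  popped w (stack (L ++ v ∷ M))  ≡⟨ cong (popped w) (stack-++-∷ L v<L v<M) ⟩
  popped w (stack M ∷ʳ v)        ≡⟨ cong length (takeWhile-++-reject (w ℤ.<?_) (stack M) (ℤP.<-asym v<w)) ⟩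
  popped w (stack M)             ∎
  where open ≡-Reasoning

popped-dropWhile : ∀ {a b} → a ℤ.< b → ∀ S → popped b S + popped a (dropWhile (b ℤ.<?_) S) ≡ popped a S
popped-dropWhile {a} {b} a<b S = begin
  popped b S + popped a (dropWhile (b ℤ.<?_) S)
    ≡⟨ length-++ (takeWhile (b ℤ.<?_) S) ⟨
  length (takeWhile (b ℤ.<?_) S ++ takeWhile (a ℤ.<?_) (dropWhile (b ℤ.<?_) S))
    ≡⟨ cong length (takeWhile++takeWhile-dropWhile (b ℤ.<?_) (a ℤ.<?_) (ℤP.<-trans a<b) S) ⟩
  popped a S
    ∎
  where open ≡-Reasoning

popped-mono : ∀ {a b} → a ℤ.< b → ∀ S → popped b S ≤ popped a S
popped-mono {a} {b} a<b S = subst (popped b S ≤_) (popped-dropWhile a<b S) (m≤m+n _ _)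

popped-push : ∀ {a b} → a ℤ.< b → ∀ S → popped a (push S b) + popped b S ≡ popped a S + 1
popped-push {a} {b} a<b S = begin
  popped a (push S b) + popped b S  ≡⟨ cong (λ T → length T + popped b S) (takeWhile-accept (a ℤ.<?_) a<b) ⟩
  suc (X + popped b S)              ≡⟨ cong suc (+-comm X (popped b S)) ⟩
  suc (popped b S + X)              ≡⟨ cong suc (popped-dropWhile a<b S) ⟩
  suc (popped a S)                  ≡⟨ +-comm 1 (popped a S) ⟩
  popped a S + 1                    ∎
  where
    open ≡-Reasoning
    X : ℕ
    X = popped a (dropWhile (b ℤ.<?_) S)

popped-swap : ∀ P {a b c} Q → a ℤ.< b → c ℤ.< b → All (b ℤ.<_) Q →
  popped c (stack (P ++ b ∷ a ∷ Q)) + 1 ≡ popped c (stack (P ++ a ∷ b ∷ Q))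
popped-swap P {a} {b} {c} Q a<b c<b b<Q = begin
  popped c (stack (P ++ b ∷ a ∷ Q)) + 1      ≡⟨ cong (λ S → popped c S + 1) stack-ba ⟩
  popped c (stack Q ++ a ∷ D) + 1            ≡⟨ cong (_+ 1) (popped-++ (a ∷ D) c<Q) ⟩
  length (stack Q) + popped c (a ∷ D) + 1    ≡⟨ +-assoc (length (stack Q)) _ 1 ⟩
  length (stack Q) + (popped c (a ∷ D) + 1)  ≡⟨ cong (length (stack Q) +_) (+-comm _ 1) ⟩
  length (stack Q) + suc (popped c (a ∷ D))
    ≡⟨ cong (λ S → length (stack Q) + length S) (takeWhile-accept (c ℤ.<?_) c<b) ⟨
  length (stack Q) + popped c (b ∷ a ∷ D)    ≡⟨ popped-++ (b ∷ a ∷ D) c<Q ⟨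
  popped c (stack Q ++ b ∷ a ∷ D)            ≡⟨ cong (popped c) stack-ab ⟨
  popped c (stack (P ++ a ∷ b ∷ Q))          ∎
  where
    open ≡-Reasoning
    D : List ℤ
    D = dropWhile (a ℤ.<?_) (stack P)
    c<Q : All (c ℤ.<_) (stack Q)
    c<Q = stack⁺ (All.map (ℤP.<-trans c<b) b<Q)
    stack-ab : stack (P ++ a ∷ b ∷ Q) ≡ stack Q ++ b ∷ a ∷ D
    stack-ab = begin
      stack (P ++ a ∷ b ∷ Q)                    ≡⟨ foldl-++ push [] P (a ∷ b ∷ Q) ⟩
      foldl push (push (push (stack P) a) b) Q
        ≡⟨ cong (λ U → foldl push (b ∷ U) Q) (dropWhile-++-reject (b ℤ.<?_) [] (ℤP.<-asym a<b)) ⟩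
      foldl push ([] ++ b ∷ a ∷ D) Q            ≡⟨ foldl-push-++-∷ [] (a ∷ D) b<Q ⟩
      stack Q ++ b ∷ a ∷ D                      ∎
    stack-ba : stack (P ++ b ∷ a ∷ Q) ≡ stack Q ++ a ∷ D
    stack-ba = begin
      stack (P ++ b ∷ a ∷ Q)                    ≡⟨ foldl-++ push [] P (b ∷ a ∷ Q) ⟩
      foldl push (push (push (stack P) b) a) Q
        ≡⟨ cong (λ U → foldl push (a ∷ U) Q)
                (trans (dropWhile-accept (a ℤ.<?_) a<b)
                       (dropWhile-dropWhile (b ℤ.<?_) (a ℤ.<?_) (ℤP.<-trans a<b) (stack P))) ⟩
      foldl push ([] ++ a ∷ D) Q                ≡⟨ foldl-push-++-∷ [] D (All.map (ℤP.<-trans a<b) b<Q) ⟩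
      stack Q ++ a ∷ D                          ∎

-- Cartesian trees

minIdx-split : ∀ a xs → let (g , v) = minIdx a xs in
  (a ∷ xs ≡ take g (a ∷ xs) ++ v ∷ drop (suc g) (a ∷ xs)) × length (take g (a ∷ xs)) ≡ g ×
  All (v ℤ.≤_) (take g (a ∷ xs)) × All (v ℤ.≤_) (drop (suc g) (a ∷ xs))
minIdx-split a [] = refl , refl , [] , []
minIdx-split a (b ∷ bs) with minIdx b bs | minIdx-split b bs
... | k , v | eq , len , v≤L , v≤R with v ℤ.<? a
...   | yes v<a = cong (a ∷_) eq , cong suc len , ℤP.<⇒≤ v<a ∷ v≤L , v≤R
...   | no v≮a  = refl , refl , [] ,
    All.map (ℤP.≤-trans (ℤP.≮⇒≥ v≮a)) (subst (All (v ℤ.≤_)) (sym eq) (++⁺ v≤L (ℤP.≤-refl ∷ v≤R)))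

data Pivot : ℕ → ℕ → List ℤ → Set where
  empty : ∀ {n off} → ctF n off [] ≡ leaf → Pivot n off []
  pivot : ∀ {n off L v R} → Unique L → Unique R → All (v ℤ.<_) L → All (v ℤ.<_) R →
          length L ≤ n → length R ≤ n →
          ctF (suc n) off (L ++ v ∷ R) ≡
            node (ctF n off L) (off + suc (length L)) (ctF n (off + suc (length L)) R) →
          Pivot (suc n) off (L ++ v ∷ R)

ctF-pivot : ∀ n off xs → Unique xs → length xs ≤ n → Pivot n off xs
ctF-pivot zero    off []       _ _  = empty refl
ctF-pivot (suc n) off []       _ _  = empty refl
ctF-pivot zero    off (a ∷ xs) _ ()
ctF-pivot (suc n) off (a ∷ xs) u len =
  let eq , |L|≡g , v≤L , v≤R = minIdx-split a xs
      uL , uR , v≢L , v≢R     = Unique-++-∷⁻ L (subst Unique eq u)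
      len′                    = subst (λ ys → length ys ≤ suc n) eq len
  in subst (Pivot (suc n) off) (sym eq)
       (pivot uL uR (All-≤∧≢⇒< v≤L v≢L) (All-≤∧≢⇒< v≤R v≢R)
              (≤-pred (≤-trans (length-<-++-∷ˡ L) len′)) (≤-pred (≤-trans (length-<-++-∷ʳ L) len′))
              (trans (cong (ctF (suc n) off) (sym eq))
                     (cong (λ g → node (ctF n off L) (off + suc g) (ctF n (off + suc g) R)) (sym |L|≡g))))
  where
    g : ℕ
    g = proj₁ (minIdx a xs)
    L R : List ℤ
    L = take g (a ∷ xs)
    R = drop (suc g) (a ∷ xs)

subtreeAt-here : ∀ l k r → subtreeAt k (node l k r) ≡ just (node l k r)
subtreeAt-here l k r with k ℕ.≟ k
... | yes _  = refl
... | no k≢k = contradiction refl k≢k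

subtreeAt-left : ∀ {h l k r t} → h ≢ k → subtreeAt h l ≡ just t → subtreeAt h (node l k r) ≡ just t
subtreeAt-left {h} {k = k} h≢k e with h ℕ.≟ k
... | yes h≡k = contradiction h≡k h≢k
... | no _ rewrite e = refl

subtreeAt-right : ∀ {h l k r} → h ≢ k → subtreeAt h l ≡ nothing → subtreeAt h (node l k r) ≡ subtreeAt h r
subtreeAt-right {h} {k = k} h≢k e with h ℕ.≟ k
... | yes h≡k = contradiction h≡k h≢k
... | no _ rewrite e = refl

subtreeAt-ctF-beyond : ∀ n off xs {h} → Unique xs → length xs ≤ n → off + length xs < h →
  subtreeAt h (ctF n off xs) ≡ nothing

subtreeAt-skip-left : ∀ n off L {r h} → Unique L → length L ≤ n → off + suc (length L) < h →
  subtreeAt h (node (ctF n off L) (off + suc (length L)) r) ≡ subtreeAt h r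
subtreeAt-skip-left n off L uL nL k<h =
  subtreeAt-right (>⇒≢ k<h) (subtreeAt-ctF-beyond n off L uL nL (<-trans (+-monoʳ-< off (n<1+n _)) k<h))

subtreeAt-ctF-beyond n off xs {h} u len xs<h with ctF-pivot n off xs u len
... | empty ctF≡ = cong (subtreeAt h) ctF≡
... | pivot {n} {L = L} {v} {R} uL uR _ _ nL nR ctF≡ = begin
  subtreeAt h (ctF (suc n) off (L ++ v ∷ R))      ≡⟨ cong (subtreeAt h) ctF≡ ⟩
  subtreeAt h (node (ctF n off L) k (ctF n k R))  ≡⟨ subtreeAt-skip-left n off L uL nL k<h ⟩
  subtreeAt h (ctF n k R)                         ≡⟨ subtreeAt-ctF-beyond n k R uR nR R<h ⟩
  nothing                                         ∎
  where
    open ≡-Reasoning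
    k : ℕ
    k = off + suc (length L)
    k<h : k < h
    k<h = ≤-<-trans (+-monoʳ-≤ off (length-<-++-∷ˡ L)) xs<h
    R<h : k + length R < h
    R<h = subst (_< h) (sym (trans (+-suc-length-++ off L R) (cong (off +_) (sym (length-++-sucʳ L v R))))) xs<h

rightBranch-ctF : ∀ n off xs → Unique xs → length xs ≤ n → rightBranch (ctF n off xs) ≡ length (stack xs)
rightBranch-ctF n off xs u len with ctF-pivot n off xs u len
... | empty ctF≡ = cong rightBranch ctF≡
... | pivot {n} {L = L} {v} {R} uL uR v<L v<R nL nR ctF≡ = begin
  rightBranch (ctF (suc n) off (L ++ v ∷ R))             ≡⟨ cong rightBranch ctF≡ ⟩
  suc (rightBranch (ctF n (off + suc (length L)) R))     ≡⟨ cong suc (rightBranch-ctF n _ R uR nR) ⟩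
  suc (length (stack R))                                 ≡⟨ length-∷ʳ (stack R) ⟨
  length (stack R ∷ʳ v)                                  ≡⟨ cong length (stack-++-∷ L v<L v<R) ⟨
  length (stack (L ++ v ∷ R))                            ∎
  where open ≡-Reasoning

subtreeAt-ctF : ∀ n off {xs} P w Q → Unique xs → length xs ≤ n → xs ≡ P ++ w ∷ Q →
  ∃[ t ] subtreeAt (off + suc (length P)) (ctF n off xs) ≡ just t × rightBranch (leftSub t) ≡ popped w (stack P)
subtreeAt-ctF n off {xs} P w Q u len eq with ctF-pivot n off xs u len
... | empty _ = contradiction eq ([]≢++∷ P)
... | pivot {n} {L = L} {v} {R} uL uR v<L v<R nL nR ctF≡ with cuts P w Q L v R (sym eq)
...   | before _ _ M _ _ =
  let t , at≡ , rb≡ = subtreeAt-ctF n off P w M uL nL refl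
  in t , trans (cong (subtreeAt _) ctF≡) (subtreeAt-left (<⇒≢ (+-monoʳ-< off (s≤s (length-<-++-∷ˡ P)))) at≡) ,
     rb≡
...   | same _ _ _ =
  node (ctF n off P) k (ctF n k R) ,
  trans (cong (subtreeAt k) ctF≡) (subtreeAt-here _ k _) ,
  trans (rightBranch-ctF n off P uL nL) (cong length (sym (takeWhile-all (w ℤ.<?_) (stack⁺ v<L))))
  where
    k : ℕ
    k = off + suc (length P)
...   | after _ _ M _ _ =
  let t , at≡ , rb≡ = subtreeAt-ctF n k M w Q uR nR refl
  in t , (begin
    subtreeAt h (ctF (suc n) off (L ++ v ∷ R))      ≡⟨ cong (subtreeAt h) ctF≡ ⟩
    subtreeAt h (node (ctF n off L) k (ctF n k R))  ≡⟨ subtreeAt-skip-left n off L uL nL k<h ⟩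
    subtreeAt h (ctF n k R)
      ≡⟨ cong (λ i → subtreeAt i (ctF n k R)) (+-suc-length-++ off L (v ∷ M)) ⟨
    subtreeAt (k + suc (length M)) (ctF n k R)      ≡⟨ at≡ ⟩
    just t                                          ∎) ,
    trans rb≡ (sym (popped-stack-++-∷ L v<L (++⁻ˡ M v<R) (All.head (++⁻ʳ M v<R))))
  where
    open ≡-Reasoning
    k h : ℕ
    k = off + suc (length L)
    h = off + suc (length (L ++ v ∷ M))
    k<h : k < h
    k<h = +-monoʳ-< off (s≤s (length-<-++-∷ˡ L))

SN-split : ∀ {x h} P w Q → Unique x → x ≡ P ++ w ∷ Q → h ≡ suc (length P) →
  SN x h ≡ popped w (stack P)
SN-split {x} P w Q u eq refl with subtreeAt-ctF (length x) 0 P w Q u ≤-refl eq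
... | t , at≡ , rb≡ rewrite at≡ = rb≡

get-split : ∀ {x h} P w Q → x ≡ P ++ w ∷ Q → h ≡ suc (length P) → get x h ≡ w
get-split []      w Q refl refl = refl
get-split (_ ∷ P) w Q refl refl = get-split P w Q refl refl

get-after : ∀ P w S k → get (P ++ w ∷ S) (suc (suc (length P + k))) ≡ get S (suc k)
get-after []      w S k = refl
get-after (_ ∷ P) w S k = get-after P w S k

length-++-∷-∸ : ∀ P (w : ℤ) S → length (P ++ w ∷ S) ∸ suc (length P) ≡ length S
length-++-∷-∸ []      w S = refl
length-++-∷-∸ (_ ∷ P) w S = length-++-∷-∸ P w S

head?-filter-applyUpTo : ∀ {p} {Pr : Pred ℤ p} (Pr? : Decidable Pr) (val : ℕ → ℤ) (f : ℕ → ℕ) S →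
  (∀ k → val (f k) ≡ get S (suc k)) →
  ∀ {r} → head? (filter (Pr? ∘ val) (applyUpTo f (length S))) ≡ just r →
  ∃[ Q ] ∃[ c ] ∃[ S′ ] S ≡ Q ++ c ∷ S′ × r ≡ f (length Q) × Pr c × All (∁ Pr) Q
head?-filter-applyUpTo Pr? val f [] val≡ ()
head?-filter-applyUpTo {Pr = Pr} Pr? val f (s ∷ S) val≡ e with Pr? (val (f 0))
... | yes pr with refl ← e = [] , s , S , refl , refl , subst Pr (val≡ 0) pr , []
... | no ¬pr =
  let Q , c , S′ , S≡ , r≡ , pc , ¬pQ = head?-filter-applyUpTo Pr? val (f ∘ suc) S (val≡ ∘ suc) e
  in s ∷ Q , c , S′ , cong (s ∷_) S≡ , r≡ , pc , (¬pr ∘ subst Pr (sym (val≡ 0))) ∷ ¬pQ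

ref-split : ∀ {x h} P w S → x ≡ P ++ w ∷ S → h ≡ suc (length P) → ∀ {r} → ref x h ≡ just r →
  ∃[ Q ] ∃[ c ] ∃[ S′ ] S ≡ Q ++ c ∷ S′ × r ≡ suc (h + length Q) ×
                        c ℤ.< w × All (λ q → ¬ q ℤ.< w) Q
ref-split {x} {h} P w S refl refl {r} e =
  let Q , c , S′ , S≡ , r≡ , c<xh , Q≮xh =
        head?-filter-applyUpTo (ℤ._<? get x h) (get x) (λ k → suc h + k) S (get-after P w S) e′
  in Q , c , S′ , S≡ , r≡ ,
     subst (c ℤ.<_) xh≡w c<xh , subst (λ t → All (λ q → ¬ q ℤ.< t) Q) xh≡w Q≮xh
  where
    xh≡w : get x h ≡ w
    xh≡w = get-split P w S refl refl
    e′ : head? (filter (λ j → get x j ℤ.<? get x h) (applyUpTo (λ k → suc h + k) (length S))) ≡ just r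
    e′ = subst (λ n → head? (filter (λ j → get x j ℤ.<? get x h) (applyUpTo (λ k → suc h + k) n)) ≡ just r)
               (length-++-∷-∸ P w S)
               (trans (cong (λ js → head? (filter (λ j → get x j ℤ.<? get x h) js))
                            (sym (map-applyUpTo id (λ k → suc h + k) (length x ∸ h)))) e)

-- Exchanging an ascent

splitAt-adjacent : ∀ (x : List ℤ) p → suc p < length x →
  ∃[ P ] ∃[ a ] ∃[ b ] ∃[ S ] x ≡ P ++ a ∷ b ∷ S × length P ≡ p
splitAt-adjacent (a ∷ b ∷ S) zero    _         = [] , a , b , S , refl , refl
splitAt-adjacent (c ∷ x)     (suc p) (s≤s p<m) =
  let P , a , b , S , x≡ , |P|≡p = splitAt-adjacent x p p<m
  in c ∷ P , a , b , S , cong (c ∷_) x≡ , cong suc |P|≡p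

τ-swap : ∀ P (a b : ℤ) S → τ (P ++ a ∷ b ∷ S) (suc (length P)) ≡ P ++ b ∷ a ∷ S
τ-swap []          a b S = refl
τ-swap (c ∷ [])    a b S = refl
τ-swap (c ∷ d ∷ P) a b S = cong (c ∷_) (τ-swap (d ∷ P) a b S)

second-cut : ∀ P (c d : ℤ) S →
  P ++ c ∷ d ∷ S ≡ (P ∷ʳ c) ++ d ∷ S × suc (suc (length P)) ≡ suc (length (P ∷ʳ c))
second-cut P c d S = sym (∷ʳ-++ P c (d ∷ S)) , cong suc (sym (length-∷ʳ P))

SN-ref-swap : ∀ P {a b} S → Unique (P ++ a ∷ b ∷ S) → a ℤ.< b → ∀ {r} →
  ref (P ++ a ∷ b ∷ S) (suc (suc (length P))) ≡ just r →
  SN (P ++ b ∷ a ∷ S) r + 1 ≡ SN (P ++ a ∷ b ∷ S) r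
SN-ref-swap P {a} {b} S u a<b e
  with Q , c , S′ , refl , refl , c<b , Q≮b ← uncurry (ref-split (P ∷ʳ a) b S) (second-cut P a b S) e
  = begin
  SN (P ++ b ∷ a ∷ Q ++ c ∷ S′) _ + 1
    ≡⟨ cong (_+ 1) (SN-split (P ++ b ∷ a ∷ Q) c S′ (Unique-swap P _ u) (sym (++-assoc P _ _)) (position b a)) ⟩
  popped c (stack (P ++ b ∷ a ∷ Q)) + 1
    ≡⟨ popped-swap P Q a<b c<b b<Q ⟩
  popped c (stack (P ++ a ∷ b ∷ Q))
    ≡⟨ SN-split (P ++ a ∷ b ∷ Q) c S′ u (sym (++-assoc P _ _)) (position a b) ⟨
  SN (P ++ a ∷ b ∷ Q ++ c ∷ S′) _
    ∎
  where
    open ≡-Reasoning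
    position : ∀ d e → suc (suc (suc (length P + length Q))) ≡ suc (length (P ++ d ∷ e ∷ Q))
    position d e = cong suc (sym (length-++-∷-∷ P Q))
    b≢Q : All (b ≢_) Q
    b≢Q with _ , (b∉ ∷ _) , _ ← Unique-++-∷⁻ P u = ++⁻ˡ Q b∉
    b<Q : All (b ℤ.<_) Q
    b<Q = All-≤∧≢⇒< (All.map ℤP.≮⇒≥ Q≮b) b≢Q

lemma18 : (x : List ℤ) → Unique x → (i : ℕ) → 1 ≤ i → i < length x →
    get x i ℤ.< get x (suc i) →
    (SN (τ x i) i ≤ SN x i)
    × (SN (τ x i) (suc i) + SN (τ x i) i ≡ SN x i + 1)
    × ((r : ℕ) → ref x (suc i) ≡ just r → SN (τ x i) r + 1 ≡ SN x r)
lemma18 x u (suc p) (s≤s z≤n) i<m x[i]<x[i+1] with splitAt-adjacent x p i<m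
... | P , a , b , S , refl , refl rewrite τ-swap P a b S =
  subst₂ _≤_ (sym SNy[i]) (sym SNx[i]) (popped-mono a<b (stack P)) ,
  trans (cong₂ _+_ SNy[i+1] SNy[i]) (trans (popped-push a<b (stack P)) (cong (_+ 1) (sym SNx[i]))) ,
  λ r → SN-ref-swap P S u a<b
  where
    uy : Unique (P ++ b ∷ a ∷ S)
    uy = Unique-swap P S u
    a<b : a ℤ.< b
    a<b = subst₂ ℤ._<_ (get-split P a (b ∷ S) refl refl) (uncurry (get-split (P ∷ʳ a) b S) (second-cut P a b S))
                 x[i]<x[i+1]
    SNx[i] : SN (P ++ a ∷ b ∷ S) (suc (length P)) ≡ popped a (stack P)
    SNx[i] = SN-split P a (b ∷ S) u refl refl
    SNy[i] : SN (P ++ b ∷ a ∷ S) (suc (length P)) ≡ popped b (stack P)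
    SNy[i] = SN-split P b (a ∷ S) uy refl refl
    SNy[i+1] : SN (P ++ b ∷ a ∷ S) (suc (suc (length P))) ≡ popped a (push (stack P) b)
    SNy[i+1] = trans (uncurry (SN-split (P ∷ʳ b) a S uy) (second-cut P b a S))
                     (cong (popped a) (foldl-∷ʳ push [] b P))
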